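{- Let $\mathbb{F}$ be a finite field with $|\mathbb{F}|>2$ and let $n\ge 2$. Then $\mathrm{triam}(C_{T_n(\mathbb{F})})=6$.
   Context: For a finite ring $R$ with identity, the unitary Cayley graph $C_R$ is the simple graph with vertex set $R$ in which distinct $x,y\in R$ are adjacent if and only if $x-y$ is a unit of $R$. $T_n(\mathbb{F})$ denotes the ring of all upper triangular $n\times n$ matrices over $\mathbb{F}$. For a connected graph $G$ with shortest-path distance $d_G$, set $d_G(u,v,w)=d_G(u,v)+d_G(u,w)+d_G(v,w)$; the triameter is $\mathrm{triam}(G)=\max\{d_G(u,v,w): u,v,w\in V(G)\}$. -}

module Defs where

open import Level using (0ℓ)
open import Data.Nat using (ℕ; zero; suc; _+_; _≤_; _<_)
open import Data.Fin using (Fin; toℕ; _≟_)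
open import Data.Bool using (if_then_else_)
open import Relation.Nullary.Decidable using (⌊_⌋)
open import Data.Vec using (Vec; lookup; tabulate; foldr; allFin; map)
open import Data.Product using (Σ; ∃; _×_; _,_)
open import Relation.Binary.PropositionalEquality using (_≡_; _≢_)
open import Relation.Nullary using (¬_)
open import Algebra.Structures using (IsCommutativeRing)
open import Function.Bundles using (_↔_)

record FiniteField : Set₁ where
  field
    Carrier : Set
    _+F_ : Carrier → Carrier → Carrier
    _*F_ : Carrier → Carrier → Carrier
    -F_  : Carrier → Carrier
    0F 1F : Carrier
    isCommutativeRing : IsCommutativeRing _≡_ _+F_ _*F_ -F_ 0F 1F
    0≢1 : 0F ≢ 1F
    inverse : ∀ x → x ≢ 0F → ∃ λ y → x *F y ≡ 1F
    size : ℕ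
    enum : Carrier ↔ Fin size

module Matrices (F : FiniteField) (n : ℕ) where
  open FiniteField F

  Matrix : Set
  Matrix = Vec (Vec Carrier n) n

  entry : Matrix → Fin n → Fin n → Carrier
  entry A i j = lookup (lookup A i) j

  _⊕_ : Matrix → Matrix → Matrix
  A ⊕ B = tabulate λ i → tabulate λ j → entry A i j +F entry B i j

  ⊖_ : Matrix → Matrix
  ⊖ A = tabulate λ i → tabulate λ j → -F (entry A i j)

  _⊝_ : Matrix → Matrix → Matrix
  A ⊝ B = A ⊕ (⊖ B)

  _⊗_ : Matrix → Matrix → Matrix
  A ⊗ B = tabulate λ i → tabulate λ j →
            foldr (λ _ → Carrier) _+F_ 0F (map (λ k → entry A i k *F entry B k j) (allFin n))

  I : Matrix
  I = tabulate λ i → tabulate λ j → if ⌊ i ≟ j ⌋ then 1F else 0F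

  UpperTriangular : Matrix → Set
  UpperTriangular A = ∀ (i j : Fin n) → toℕ j < toℕ i → entry A i j ≡ 0F

  IsUnit : Matrix → Set
  IsUnit A = UpperTriangular A × ∃ λ B → UpperTriangular B × (A ⊗ B ≡ I) × (B ⊗ A ≡ I)

  -- unitary Cayley graph C_{T_n(F)}: vertex set T_n(F)
  Adj : Matrix → Matrix → Set
  Adj x y = UpperTriangular x × UpperTriangular y × x ≢ y × IsUnit (x ⊝ y)

  data Walk : ℕ → Matrix → Matrix → Set where
    here : ∀ {x} → UpperTriangular x → Walk zero x x
    step : ∀ {k x y z} → Adj x y → Walk k y z → Walk (suc k) x z

  Dist : Matrix → Matrix → ℕ → Set
  Dist x y k = Walk k x y × (∀ m → Walk m x y → k ≤ m)

  Connected : Set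
  Connected = ∀ x y → UpperTriangular x → UpperTriangular y → ∃ λ k → Dist x y k

  Triameter≡ : ℕ → Set
  Triameter≡ t =
    Connected ×
    (∃ λ u → ∃ λ v → ∃ λ w → UpperTriangular u × UpperTriangular v × UpperTriangular w ×
       ∃ λ a → ∃ λ b → ∃ λ c → Dist u v a × Dist u w b × Dist v w c × a + b + c ≡ t) ×
    (∀ u v w → UpperTriangular u → UpperTriangular v → UpperTriangular w →
       ∀ a b c → Dist u v a → Dist u w b → Dist v w c → a + b + c ≤ t)

-- An upper triangular matrix is a unit of T_n(F) exactly when its diagonal entries are all nonzero
-- (the inverse is built by block recursion on the first row), so x and y are adjacent iff their
-- diagonals differ in every position. As |F| ≥ 3, any x and y have a common neighbour: a diagonal
-- matrix whose i-th entry avoids both x_ii and y_ii. Hence all distances are at most 2 and the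
-- triameter is at most 6. Conversely diag(0, a, …, a) for three distinct a are pairwise distinct
-- and pairwise non-adjacent (they agree in position (0,0)), so all three distances equal 2.
module Submission where

open import Level using (0ℓ; _⊔_)
open import Algebra.Bundles using (CommutativeRing)
open import Data.Nat using (ℕ; zero; suc; _≤_; _<_; z≤n; s≤s)
open import Data.Nat.Properties using (<-irrefl; +-mono-≤)
open import Data.Fin using (Fin; zero; suc; toℕ; _≟_)
open import Data.Fin.Properties using (<-cmp; punchInᵢ≢i; all?; inj⇒≟)
open import Data.Vec using (Vec; lookup; tabulate; foldr; map; allFin)
open import Data.Vec.Properties using (lookup∘tabulate; tabulate∘lookup; tabulate-cong; tabulate-allFin; ≡-dec)
open import Data.Vec.Functional using (Vector; removeAt)
open import Data.Bool using (if_then_else_)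
open import Data.Product using (∃; _×_; _,_; proj₁; proj₂)
open import Function using (_∘_; _↔_; Inverse)
open import Function.Properties.Inverse using (↔⇒↣)
open import Relation.Binary.Definitions using (DecidableEquality; tri<; tri≈; tri>)
open import Relation.Binary.PropositionalEquality using (_≡_; _≢_; refl; cong)
import Relation.Binary.PropositionalEquality as ≡
open import Relation.Nullary using (¬_; yes; no; ¬?; contradiction)
open import Relation.Nullary.Decidable using (⌊_⌋)

open import Defs

module TriangularMatrices {c ℓ} (R : CommutativeRing c ℓ) where
  open CommutativeRing R renaming (refl to ≈-refl) hiding (zero)
  open import Algebra.Properties.Ring ring using (-‿distribˡ-*; -‿distribʳ-*)
  open import Algebra.Properties.Semiring.Sum semiring
    using (sum; sum-syntax; sum-cong-≋; sum-replicate-zero; sum-remove; ∑-comm; *-distribˡ-sum; *-distribʳ-sum)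
  open import Relation.Binary.Reasoning.Setoid setoid

  Mat : ℕ → Set c
  Mat m = Fin m → Fin m → Carrier

  infixl 7 _ᵥ·_ _·_

  _ᵥ·_ : ∀ {m} → Vector Carrier m → Mat m → Vector Carrier m
  _ᵥ·_ {m} r B j = ∑[ k < m ] (r k * B k j)

  _·_ : ∀ {m} → Mat m → Mat m → Mat m
  (A · B) i = A i ᵥ· B

  diagonal : ∀ {m} → Vector Carrier m → Mat m
  diagonal d i j = if ⌊ i ≟ j ⌋ then d i else 0#

  1M : ∀ {m} → Mat m
  1M = diagonal (λ _ → 1#)

  IsUpperTriangular : ∀ {m} → Mat m → Set ℓ
  IsUpperTriangular A = ∀ i j → toℕ j < toℕ i → A i j ≈ 0#

  diagonal-≡ : ∀ {m} (d : Vector Carrier m) i → diagonal d i i ≡ d i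
  diagonal-≡ d i with i ≟ i
  ... | yes _   = refl
  ... | no i≢i = contradiction refl i≢i

  diagonal-≢ : ∀ {m} (d : Vector Carrier m) {i j} → i ≢ j → diagonal d i j ≡ 0#
  diagonal-≢ d {i} {j} i≢j with i ≟ j
  ... | yes i≡j = contradiction i≡j i≢j
  ... | no _    = refl

  diagonal-suc : ∀ {m} (d : Vector Carrier (suc m)) i j → diagonal d (suc i) (suc j) ≡ diagonal (d ∘ suc) i j
  diagonal-suc d i j with i ≟ j
  ... | yes _ = refl
  ... | no _  = refl

  diagonal-upper : ∀ {m} (d : Vector Carrier m) → IsUpperTriangular (diagonal d)
  diagonal-upper d i j j<i = reflexive (diagonal-≢ d (λ { refl → <-irrefl refl j<i }))

  sum-zero : ∀ {m} {f : Vector Carrier m} → (∀ k → f k ≈ 0#) → sum f ≈ 0#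
  sum-zero {m} f≈0 = trans (sum-cong-≋ f≈0) (sum-replicate-zero m)

  sum-single : ∀ {m} {f : Vector Carrier m} i → (∀ k → k ≢ i → f k ≈ 0#) → sum f ≈ f i
  sum-single {suc _} {f} i off = begin
    sum f                     ≈⟨ sum-remove {i = i} f ⟩
    f i + sum (removeAt f i)  ≈⟨ +-congˡ (sum-zero (λ k → off _ (punchInᵢ≢i i k))) ⟩
    f i + 0#                  ≈⟨ +-identityʳ (f i) ⟩
    f i                       ∎

  ᵥ·-identityʳ : ∀ {m} (r : Vector Carrier m) j → (r ᵥ· 1M) j ≈ r j
  ᵥ·-identityʳ r j = begin
    (r ᵥ· 1M) j     ≈⟨ sum-single j (λ k k≢j → trans (*-congˡ (reflexive (diagonal-≢ _ k≢j))) (zeroʳ (r k))) ⟩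
    r j * 1M j j    ≡⟨ cong (r j *_) (diagonal-≡ _ j) ⟩
    r j * 1#        ≈⟨ *-identityʳ (r j) ⟩
    r j             ∎

  ᵥ·-assoc : ∀ {m} (r : Vector Carrier m) (A B : Mat m) j → (r ᵥ· A ᵥ· B) j ≈ (r ᵥ· (A · B)) j
  ᵥ·-assoc {m} r A B j = begin
    ∑[ k < m ] ((r ᵥ· A) k * B k j)                  ≈⟨ sum-cong-≋ (λ k → *-distribʳ-sum (B k j) (λ l → r l * A l k)) ⟩
    ∑[ k < m ] ∑[ l < m ] ((r l * A l k) * B k j)    ≈⟨ sum-cong-≋ (λ k → sum-cong-≋ (λ l → *-assoc (r l) (A l k) (B k j))) ⟩
    ∑[ k < m ] ∑[ l < m ] (r l * (A l k * B k j))    ≈⟨ ∑-comm (λ k l → r l * (A l k * B k j)) ⟩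
    ∑[ l < m ] ∑[ k < m ] (r l * (A l k * B k j))    ≈⟨ sum-cong-≋ (λ l → sym (*-distribˡ-sum (r l) (λ k → A l k * B k j))) ⟩
    ∑[ l < m ] (r l * (A · B) l j)                   ∎

  ·-diagonal : ∀ {m} {A B : Mat m} → IsUpperTriangular A → IsUpperTriangular B →
               ∀ i → (A · B) i i ≈ A i i * B i i
  ·-diagonal {A = A} {B} A-upper B-upper i = sum-single i off
    where
    off : ∀ k → k ≢ i → A i k * B k i ≈ 0#
    off k k≢i with <-cmp k i
    ... | tri< k<i _ _ = trans (*-congʳ (A-upper i k k<i)) (zeroˡ (B k i))
    ... | tri≈ _ k≡i _ = contradiction k≡i k≢i
    ... | tri> _ _ i<k = trans (*-congˡ (B-upper k i i<k)) (zeroʳ (A i k))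

  ·-cong : ∀ {m} {A A′ B B′ : Mat m} → (∀ i j → A i j ≈ A′ i j) → (∀ i j → B i j ≈ B′ i j) →
           ∀ i j → (A · B) i j ≈ (A′ · B′) i j
  ·-cong {m} A≈A′ B≈B′ i j = sum-cong-≋ {m} (λ k → *-cong (A≈A′ i k) (B≈B′ k j))

  ·≈1M⇒diagonal-inverse : ∀ {m} {A B : Mat m} → IsUpperTriangular A → IsUpperTriangular B →
                          (∀ i j → (A · B) i j ≈ 1M i j) → ∀ i → A i i * B i i ≈ 1#
  ·≈1M⇒diagonal-inverse {A = A} {B} A-upper B-upper AB≈1 i = begin
    A i i * B i i   ≈⟨ ·-diagonal A-upper B-upper i ⟨
    (A · B) i i     ≈⟨ AB≈1 i i ⟩
    1M i i          ≡⟨ diagonal-≡ _ i ⟩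
    1#              ∎

  record UpperTriangularInverse {m} (M : Mat m) : Set (c ⊔ ℓ) where
    field
      inv       : Mat m
      inv-upper : IsUpperTriangular inv
      inverseʳ  : ∀ i j → (M · inv) i j ≈ 1M i j
      inverseˡ  : ∀ i j → (inv · M) i j ≈ 1M i j

  -- The inverse of [[a, r], [0, M′]] is [[a⁻¹, -a⁻¹ (r N′)], [0, N′]], where N′ is the inverse of M′.
  module Block {m} (M : Mat (suc m)) (M-upper : IsUpperTriangular M)
               (a⁻¹ : Carrier) (aa⁻¹≈1 : M zero zero * a⁻¹ ≈ 1#)
               (M′⁻¹ : UpperTriangularInverse (λ i j → M (suc i) (suc j))) where
    a : Carrier
    a = M zero zero
    r : Vector Carrier m
    r j = M zero (suc j)
    M′ : Mat m
    M′ i j = M (suc i) (suc j)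
    open UpperTriangularInverse M′⁻¹
      renaming (inv to N′; inv-upper to N′-upper; inverseʳ to M′N′≈1; inverseˡ to N′M′≈1)
    s : Vector Carrier m
    s = r ᵥ· N′

    N : Mat (suc m)
    N zero    zero    = a⁻¹
    N zero    (suc j) = - (a⁻¹ * s j)
    N (suc i) zero    = 0#
    N (suc i) (suc j) = N′ i j

    N-upper : IsUpperTriangular N
    N-upper (suc i) zero    _         = ≈-refl
    N-upper (suc i) (suc j) (s≤s j<i) = N′-upper i j j<i

    column₀ : ∀ i → M (suc i) zero ≈ 0#
    column₀ i = M-upper (suc i) zero (s≤s z≤n)

    MN≈1 : ∀ i j → (M · N) i j ≈ 1M i j
    MN≈1 zero zero = begin
      a * a⁻¹ + ∑[ k < m ] (r k * 0#)   ≈⟨ +-cong aa⁻¹≈1 (sum-zero (λ k → zeroʳ (r k))) ⟩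
      1# + 0#                         ≈⟨ +-identityʳ 1# ⟩
      1#                              ∎
    MN≈1 zero (suc j) = begin
      a * - (a⁻¹ * s j) + s j     ≈⟨ +-congʳ (sym (-‿distribʳ-* a _)) ⟩
      - (a * (a⁻¹ * s j)) + s j   ≈⟨ +-congʳ (-‿cong (sym (*-assoc a a⁻¹ (s j)))) ⟩
      - (a * a⁻¹ * s j) + s j     ≈⟨ +-congʳ (-‿cong (trans (*-congʳ aa⁻¹≈1) (*-identityˡ (s j)))) ⟩
      - s j + s j                 ≈⟨ -‿inverseˡ (s j) ⟩
      0#                          ∎
    MN≈1 (suc i) zero = begin
      M (suc i) zero * a⁻¹ + ∑[ k < m ] (M′ i k * 0#)   ≈⟨ +-cong (trans (*-congʳ (column₀ i)) (zeroˡ a⁻¹))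
                                                                (sum-zero (λ k → zeroʳ (M′ i k))) ⟩
      0# + 0#                                        ≈⟨ +-identityʳ 0# ⟩
      0#                                             ∎
    MN≈1 (suc i) (suc j) = begin
      M (suc i) zero * N zero (suc j) + (M′ · N′) i j ≈⟨ +-congʳ (trans (*-congʳ (column₀ i)) (zeroˡ _)) ⟩
      0# + (M′ · N′) i j                              ≈⟨ +-identityˡ _ ⟩
      (M′ · N′) i j                                   ≈⟨ M′N′≈1 i j ⟩
      1M i j                                          ≡⟨ diagonal-suc (λ _ → 1#) i j ⟨
      1M (suc i) (suc j)                              ∎

    sM′≈r : ∀ j → (s ᵥ· M′) j ≈ r j
    sM′≈r j = begin
      (r ᵥ· N′ ᵥ· M′) j    ≈⟨ ᵥ·-assoc r N′ M′ j ⟩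
      (r ᵥ· (N′ · M′)) j   ≈⟨ sum-cong-≋ {m} (λ k → *-congˡ (N′M′≈1 k j)) ⟩
      (r ᵥ· 1M) j          ≈⟨ ᵥ·-identityʳ r j ⟩
      r j                  ∎

    NM≈1 : ∀ i j → (N · M) i j ≈ 1M i j
    NM≈1 zero zero = begin
      a⁻¹ * a + ∑[ k < m ] (N zero (suc k) * M (suc k) zero)  ≈⟨ +-cong (trans (*-comm a⁻¹ a) aa⁻¹≈1)
                                                                      (sum-zero (λ k → trans (*-congˡ (column₀ k)) (zeroʳ _))) ⟩
      1# + 0#                                              ≈⟨ +-identityʳ 1# ⟩
      1#                                                   ∎
    NM≈1 zero (suc j) = begin
      a⁻¹ * r j + ∑[ k < m ] (- (a⁻¹ * s k) * M′ k j)   ≈⟨ +-congˡ (sum-cong-≋ {m} negate-outside) ⟩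
      a⁻¹ * r j + ∑[ k < m ] (- a⁻¹ * (s k * M′ k j))   ≈⟨ +-congˡ (sym (*-distribˡ-sum (- a⁻¹) (λ k → s k * M′ k j))) ⟩
      a⁻¹ * r j + - a⁻¹ * (s ᵥ· M′) j                   ≈⟨ +-congˡ (*-congˡ (sM′≈r j)) ⟩
      a⁻¹ * r j + - a⁻¹ * r j                           ≈⟨ sym (distribʳ (r j) a⁻¹ (- a⁻¹)) ⟩
      (a⁻¹ - a⁻¹) * r j                                 ≈⟨ *-congʳ (-‿inverseʳ a⁻¹) ⟩
      0# * r j                                          ≈⟨ zeroˡ (r j) ⟩
      0#                                                ∎
      where
      negate-outside : ∀ k → - (a⁻¹ * s k) * M′ k j ≈ - a⁻¹ * (s k * M′ k j)
      negate-outside k = trans (*-congʳ (-‿distribˡ-* a⁻¹ (s k))) (*-assoc (- a⁻¹) (s k) (M′ k j))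
    NM≈1 (suc i) zero = begin
      0# * a + ∑[ k < m ] (N′ i k * M (suc k) zero)   ≈⟨ +-cong (zeroˡ a) (sum-zero (λ k → trans (*-congˡ (column₀ k)) (zeroʳ _))) ⟩
      0# + 0#                                       ≈⟨ +-identityʳ 0# ⟩
      0#                                            ∎
    NM≈1 (suc i) (suc j) = begin
      0# * M zero (suc j) + (N′ · M′) i j   ≈⟨ +-congʳ (zeroˡ _) ⟩
      0# + (N′ · M′) i j                    ≈⟨ +-identityˡ _ ⟩
      (N′ · M′) i j                         ≈⟨ N′M′≈1 i j ⟩
      1M i j                                ≡⟨ diagonal-suc (λ _ → 1#) i j ⟨
      1M (suc i) (suc j)                    ∎

    blockInverse : UpperTriangularInverse M
    blockInverse = record { inv = N ; inv-upper = N-upper ; inverseʳ = MN≈1 ; inverseˡ = NM≈1 }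

  upperTriangularInverse : ∀ {m} (M : Mat m) → IsUpperTriangular M →
                           (∀ i → ∃ λ b → M i i * b ≈ 1#) → UpperTriangularInverse M
  upperTriangularInverse {zero} M _ _ =
    record { inv = λ () ; inv-upper = λ () ; inverseʳ = λ () ; inverseˡ = λ () }
  upperTriangularInverse {suc m} M M-upper invertible =
    Block.blockInverse M M-upper (proj₁ (invertible zero)) (proj₂ (invertible zero))
      (upperTriangularInverse _ (λ i j j<i → M-upper (suc i) (suc j) (s≤s j<i)) (invertible ∘ suc))

commutativeRing : FiniteField → CommutativeRing 0ℓ 0ℓ
commutativeRing F = record
  { Carrier = Carrier ; _≈_ = _≡_ ; _+_ = _+F_ ; _*_ = _*F_ ; -_ = -F_ ; 0# = 0F ; 1# = 1F
  ; isCommutativeRing = isCommutativeRing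
  }
  where open FiniteField F

∃-≢₂ : ∀ {n} → 2 < n → (i j : Fin n) → ∃ λ k → i ≢ k × j ≢ k
∃-≢₂ (s≤s (s≤s (s≤s _))) zero          zero          = suc zero , (λ ()) , (λ ())
∃-≢₂ (s≤s (s≤s (s≤s _))) zero          (suc zero)    = suc (suc zero) , (λ ()) , (λ ())
∃-≢₂ (s≤s (s≤s (s≤s _))) zero          (suc (suc _)) = suc zero , (λ ()) , (λ ())
∃-≢₂ (s≤s (s≤s (s≤s _))) (suc zero)    zero          = suc (suc zero) , (λ ()) , (λ ())
∃-≢₂ (s≤s (s≤s (s≤s _))) (suc (suc _)) zero          = suc zero , (λ ()) , (λ ())
∃-≢₂ (s≤s (s≤s (s≤s _))) (suc _)       (suc _)       = zero , (λ ()) , (λ ())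

↔Fin⇒∃-≢₂ : ∀ {a} {A : Set a} {n} → A ↔ Fin n → 2 < n → (x y : A) → ∃ λ z → x ≢ z × y ≢ z
↔Fin⇒∃-≢₂ A↔Fin 2<n x y =
  let k , x≢k , y≢k = ∃-≢₂ 2<n (to x) (to y)
  in from k , x≢k ∘ to-from k , y≢k ∘ to-from k
  where
  open Inverse A↔Fin
  to-from : ∀ k {x} → x ≡ from k → to x ≡ k
  to-from k refl = strictlyInverseˡ k

module UnitaryCayleyGraph (F : FiniteField) (m : ℕ) where
  open FiniteField F using (Carrier; size; enum; 0≢1; inverse)
  open CommutativeRing (commutativeRing F) using (_+_; _-_; -_; _*_; 0#; 1#; zeroʳ)
  open import Algebra.Properties.Ring (CommutativeRing.ring (commutativeRing F)) using (x∙y⁻¹≈ε⇒x≈y; x≈y⇒x∙y⁻¹≈ε)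
  open import Algebra.Properties.Semiring.Sum (CommutativeRing.semiring (commutativeRing F)) using (sum)
  open TriangularMatrices (commutativeRing F)
  open Matrices F (suc m)
  open ≡.≡-Reasoning

  _≟ᶜ_ : DecidableEquality Carrier
  _≟ᶜ_ = inj⇒≟ (↔⇒↣ enum)

  toMatrix : Mat (suc m) → Matrix
  toMatrix M = tabulate λ i → tabulate (M i)

  entry-toMatrix : ∀ M i j → entry (toMatrix M) i j ≡ M i j
  entry-toMatrix M i j =
    ≡.trans (cong (λ row → lookup row j) (lookup∘tabulate (λ i → tabulate (M i)) i)) (lookup∘tabulate (M i) j)

  toMatrix-cong : ∀ {M M′} → (∀ i j → M i j ≡ M′ i j) → toMatrix M ≡ toMatrix M′
  toMatrix-cong M≡M′ = tabulate-cong (λ i → tabulate-cong (M≡M′ i))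

  toMatrix-entry : ∀ A → toMatrix (entry A) ≡ A
  toMatrix-entry A = ≡.trans (tabulate-cong (λ i → tabulate∘lookup (lookup A i))) (tabulate∘lookup A)

  vecSum : ∀ {k} → Vec Carrier k → Carrier
  vecSum = foldr (λ _ → Carrier) _+_ 0#

  vecSum-tabulate : ∀ {k} (f : Vector Carrier k) → vecSum (tabulate f) ≡ sum f
  vecSum-tabulate {zero}  f = refl
  vecSum-tabulate {suc k} f = cong (f zero +_) (vecSum-tabulate (f ∘ suc))

  entry-⊗ : ∀ A B i j → entry (A ⊗ B) i j ≡ (entry A · entry B) i j
  entry-⊗ A B i j = begin
    entry (A ⊗ B) i j                     ≡⟨ entry-toMatrix (λ i j → vecSum (map (terms i j) (allFin _))) i j ⟩
    vecSum (map (terms i j) (allFin _))   ≡⟨ cong vecSum (tabulate-allFin (terms i j)) ⟨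
    vecSum (tabulate (terms i j))         ≡⟨ vecSum-tabulate (terms i j) ⟩
    (entry A · entry B) i j               ∎
    where
    terms : Fin (suc m) → Fin (suc m) → Vector Carrier (suc m)
    terms i j k = entry A i k * entry B k j

  ⊗≡I : ∀ {A B} → (∀ i j → (entry A · entry B) i j ≡ 1M i j) → A ⊗ B ≡ I
  ⊗≡I {A} {B} AB≡1 =
    ≡.trans (≡.sym (toMatrix-entry (A ⊗ B))) (toMatrix-cong (λ i j → ≡.trans (entry-⊗ A B i j) (AB≡1 i j)))

  entry-⊝ : ∀ A B i j → entry (A ⊝ B) i j ≡ entry A i j - entry B i j
  entry-⊝ A B i j = ≡.trans (entry-toMatrix (λ i j → entry A i j + entry (⊖ B) i j) i j)
                             (cong (entry A i j +_) (entry-toMatrix (λ i j → - entry B i j) i j))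

  ⊝-upper : ∀ {A B} → UpperTriangular A → UpperTriangular B → UpperTriangular (A ⊝ B)
  ⊝-upper {A} {B} A-upper B-upper i j j<i =
    ≡.trans (entry-⊝ A B i j) (x≈y⇒x∙y⁻¹≈ε (≡.trans (A-upper i j j<i) (≡.sym (B-upper i j j<i))))

  isUnit : ∀ {M} → UpperTriangular M → (∀ i → entry M i i ≢ 0#) → IsUnit M
  isUnit {M} M-upper diagonal≢0 =
    M-upper , toMatrix inv , inv-upper′ , ⊗≡I {M} {toMatrix inv} (λ i j → ≡.trans (entry-inv·ʳ i j) (inverseʳ i j))
                                       , ⊗≡I {toMatrix inv} {M} (λ i j → ≡.trans (entry-inv·ˡ i j) (inverseˡ i j))
    where
    open UpperTriangularInverse (upperTriangularInverse (entry M) M-upper (λ i → inverse _ (diagonal≢0 i)))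
    inv-upper′ : UpperTriangular (toMatrix inv)
    inv-upper′ i j j<i = ≡.trans (entry-toMatrix inv i j) (inv-upper i j j<i)
    entry-inv·ʳ : ∀ i j → (entry M · entry (toMatrix inv)) i j ≡ (entry M · inv) i j
    entry-inv·ʳ = ·-cong {A = entry M} {B = entry (toMatrix inv)} (λ _ _ → refl) (entry-toMatrix inv)
    entry-inv·ˡ : ∀ i j → (entry (toMatrix inv) · entry M) i j ≡ (inv · entry M) i j
    entry-inv·ˡ = ·-cong {A = entry (toMatrix inv)} {B = entry M} (entry-toMatrix inv) (λ _ _ → refl)

  isUnit⇒diagonal≢0 : ∀ {M} → IsUnit M → ∀ i → entry M i i ≢ 0#
  isUnit⇒diagonal≢0 {M} (M-upper , B , B-upper , _ , BM≡I) i Mᵢᵢ≡0 = 0≢1 (begin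
    0#                     ≡⟨ zeroʳ _ ⟨
    entry B i i * 0#       ≡⟨ cong (entry B i i *_) Mᵢᵢ≡0 ⟨
    entry B i i * entry M i i
      ≡⟨ ·≈1M⇒diagonal-inverse B-upper M-upper BM≡1 i ⟩
    1#                     ∎)
    where
    BM≡1 : ∀ i j → (entry B · entry M) i j ≡ 1M i j
    BM≡1 i j = begin
      (entry B · entry M) i j   ≡⟨ entry-⊗ B M i j ⟨
      entry (B ⊗ M) i j         ≡⟨ cong (λ X → entry X i j) BM≡I ⟩
      entry I i j               ≡⟨ entry-toMatrix 1M i j ⟩
      1M i j                    ∎

  DiagonalApart : Matrix → Matrix → Set
  DiagonalApart x y = ∀ i → entry x i i ≢ entry y i i

  adj⇒diagonalApart : ∀ {x y} → Adj x y → DiagonalApart x y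
  adj⇒diagonalApart {x} {y} (_ , _ , _ , x-y-unit) i xᵢᵢ≡yᵢᵢ =
    isUnit⇒diagonal≢0 {x ⊝ y} x-y-unit i (≡.trans (entry-⊝ x y i i) (x≈y⇒x∙y⁻¹≈ε xᵢᵢ≡yᵢᵢ))

  diagonalApart⇒adj : ∀ {x y} → UpperTriangular x → UpperTriangular y → DiagonalApart x y → Adj x y
  diagonalApart⇒adj {x} {y} x-upper y-upper apart =
    x-upper , y-upper , (λ { refl → apart zero refl }) ,
    isUnit {x ⊝ y} (⊝-upper {x} {y} x-upper y-upper)
      (λ i xᵢᵢ-yᵢᵢ≡0 → apart i (x∙y⁻¹≈ε⇒x≈y _ _ (≡.trans (≡.sym (entry-⊝ x y i i)) xᵢᵢ-yᵢᵢ≡0)))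

  dist-refl : ∀ {x} → UpperTriangular x → Dist x x 0
  dist-refl x-upper = here x-upper , λ _ _ → z≤n

  dist-adj : ∀ {x y} → Adj x y → Dist x y 1
  dist-adj adj@(_ , y-upper , x≢y , _) = step adj (here y-upper) , minimal
    where
    minimal : ∀ k → Walk k _ _ → 1 ≤ k
    minimal zero    (here _) = contradiction refl x≢y
    minimal (suc _) _        = s≤s z≤n

  dist-two : ∀ {x y} → x ≢ y → ¬ Adj x y → Walk 2 x y → Dist x y 2
  dist-two {x} {y} x≢y ¬adj walk = walk , minimal
    where
    minimal : ∀ k → Walk k x y → 2 ≤ k
    minimal zero          (here _)             = contradiction refl x≢y
    minimal (suc zero)    (step adj (here _))  = contradiction adj ¬adj
    minimal (suc (suc _)) _                    = s≤s (s≤s z≤n)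

  diagonalMatrix : Vector Carrier (suc m) → Matrix
  diagonalMatrix d = toMatrix (diagonal d)

  diagonalMatrix-upper : ∀ d → UpperTriangular (diagonalMatrix d)
  diagonalMatrix-upper d i j j<i = ≡.trans (entry-toMatrix (diagonal d) i j) (diagonal-upper d i j j<i)

  entry-diagonalMatrix : ∀ d i → entry (diagonalMatrix d) i i ≡ d i
  entry-diagonalMatrix d i = ≡.trans (entry-toMatrix (diagonal d) i i) (diagonal-≡ d i)

  module _ (|F|>2 : 2 < size) where

    walk₂ : ∀ {x y} → UpperTriangular x → UpperTriangular y → Walk 2 x y
    walk₂ {x} {y} x-upper y-upper =
      step (diagonalApart⇒adj {x} {z} x-upper z-upper x-z-apart)
           (step (diagonalApart⇒adj {z} {y} z-upper y-upper z-y-apart) (here y-upper))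
      where
      avoid : ∀ i → ∃ λ c → entry x i i ≢ c × entry y i i ≢ c
      avoid i = ↔Fin⇒∃-≢₂ enum |F|>2 (entry x i i) (entry y i i)
      d : Vector Carrier (suc m)
      d = proj₁ ∘ avoid
      z : Matrix
      z = diagonalMatrix d
      z-upper : UpperTriangular z
      z-upper = diagonalMatrix-upper d
      x-z-apart : DiagonalApart x z
      x-z-apart i xᵢᵢ≡zᵢᵢ = proj₁ (proj₂ (avoid i)) (≡.trans xᵢᵢ≡zᵢᵢ (entry-diagonalMatrix d i))
      z-y-apart : DiagonalApart z y
      z-y-apart i zᵢᵢ≡yᵢᵢ = proj₂ (proj₂ (avoid i)) (≡.trans (≡.sym zᵢᵢ≡yᵢᵢ) (entry-diagonalMatrix d i))

    dist≤2 : ∀ {x y k} → UpperTriangular x → UpperTriangular y → Dist x y k → k ≤ 2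
    dist≤2 x-upper y-upper (_ , minimal) = minimal 2 (walk₂ x-upper y-upper)

    connected : Connected
    connected x y x-upper y-upper with ≡-dec (≡-dec _≟ᶜ_) x y
    ... | yes refl = 0 , dist-refl x-upper
    ... | no x≢y with all? (λ i → ¬? (entry x i i ≟ᶜ entry y i i))
    ...   | yes apart = 1 , dist-adj (diagonalApart⇒adj x-upper y-upper apart)
    ...   | no ¬apart = 2 , dist-two x≢y (¬apart ∘ adj⇒diagonalApart) (walk₂ x-upper y-upper)

    dist-diagonalMatrix : ∀ {d e} i j → d i ≡ e i → d j ≢ e j → Dist (diagonalMatrix d) (diagonalMatrix e) 2
    dist-diagonalMatrix {d} {e} i j dᵢ≡eᵢ dⱼ≢eⱼ =
      dist-two distinct (λ adj → adj⇒diagonalApart adj i meet) (walk₂ (diagonalMatrix-upper d) (diagonalMatrix-upper e))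
      where
      meet : entry (diagonalMatrix d) i i ≡ entry (diagonalMatrix e) i i
      meet = ≡.trans (entry-diagonalMatrix d i) (≡.trans dᵢ≡eᵢ (≡.sym (entry-diagonalMatrix e i)))
      distinct : diagonalMatrix d ≢ diagonalMatrix e
      distinct d≡e = dⱼ≢eⱼ (begin
        d j                              ≡⟨ entry-diagonalMatrix d j ⟨
        entry (diagonalMatrix d) j j     ≡⟨ cong (λ X → entry X j j) d≡e ⟩
        entry (diagonalMatrix e) j j     ≡⟨ entry-diagonalMatrix e j ⟩
        e j                              ∎)

proposition3 : (F : FiniteField) → 2 < FiniteField.size F →
    (n : ℕ) → 2 ≤ n → Matrices.Triameter≡ F n 6
proposition3 F |F|>2 (suc (suc k)) (s≤s (s≤s z≤n)) =
    connected |F|>2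
  , (Δ 0# , Δ 1# , Δ c , diagonalMatrix-upper (diag₀ 0#) , diagonalMatrix-upper (diag₀ 1#) , diagonalMatrix-upper (diag₀ c)
    , 2 , 2 , 2
    , dist-Δ 0≢1 , dist-Δ 0≢c , dist-Δ 1≢c , refl)
  , λ u v w u-upper v-upper w-upper _ _ _ d-uv d-uw d-vw →
      +-mono-≤ (+-mono-≤ (dist≤2 |F|>2 u-upper v-upper d-uv) (dist≤2 |F|>2 u-upper w-upper d-uw))
               (dist≤2 |F|>2 v-upper w-upper d-vw)
  where
  open FiniteField F using (Carrier; enum; 0≢1) renaming (0F to 0#; 1F to 1#)
  open UnitaryCayleyGraph F (suc k)
  open Matrices F (suc (suc k)) using (Matrix; Dist)

  diag₀ : Carrier → Vector Carrier (suc (suc k))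
  diag₀ a zero    = 0#
  diag₀ a (suc _) = a

  Δ : Carrier → Matrix
  Δ a = diagonalMatrix (diag₀ a)

  dist-Δ : ∀ {a b} → a ≢ b → Dist (Δ a) (Δ b) 2
  dist-Δ {a} {b} a≢b = dist-diagonalMatrix |F|>2 {diag₀ a} {diag₀ b} zero (suc zero) refl a≢b

  third : ∃ λ c → 0# ≢ c × 1# ≢ c
  third = ↔Fin⇒∃-≢₂ enum |F|>2 0# 1#

  c : Carrier
  c = proj₁ third

  0≢c : 0# ≢ c
  0≢c = proj₁ (proj₂ third)

  1≢c : 1# ≢ c
  1≢c = proj₂ (proj₂ third)
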